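{- For all integers $x \ge 2$, $f(x) \le x - \sqrt{x} + 1$, where $f$ is the function defined below.
   Context: Define $f:\mathbb{Z}^+\to\mathbb{Z}^+$ by $f(1)=1$, $f(2)=1$, $f(3)=2$, $f(4)=2$, and for $k>4$, $f(k)$ is the minimum of $f(k-1)+1$ and of the values $k_1k_2-k_1-k_2+1+\max(f(k_1),k_2)$, taken over all factorizations $k=k_1k_2$ with integers $k_1\ge 3$ and $k_2\ge 2$. -}

module Defs where

open import Data.Nat using (ℕ; zero; suc; _+_; _*_; _∸_; _⊓_; _⊔_; _≤?_; _/_)
open import Data.Nat.Divisibility using (_∣?_)
open import Data.Bool using (if_then_else_; _∧_)
open import Relation.Nullary using (does)

-- One step of the factorization minimum: for k2 = j+2 with k2 ∣ k and
-- k1 = k / k2 ≥ 3, candidate value k1*k2 - k1 - k2 + 1 + max (f k1) k2.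
-- minFact g k j acc takes the minimum of acc and all candidates with
-- k2 ∈ {2, …, j+1}.
minFact : (ℕ → ℕ) → ℕ → ℕ → ℕ → ℕ
minFact g k zero    acc = acc
minFact g k (suc j) acc =
  minFact g k j
    (if does (k2 ∣? k) ∧ does (3 ≤? k1)
       then acc ⊓ ((k1 * k2 ∸ k1 ∸ k2) + 1 + (g k1 ⊔ k2))
       else acc)
  where
    k2 : ℕ
    k2 = suc (suc j)
    k1 : ℕ
    k1 = k / k2

-- fuel-indexed definition; fuel n ≥ k suffices (all recursive calls are on
-- strictly smaller arguments ≥ 1).
fAux : ℕ → ℕ → ℕ
fAux zero    k = 1
fAux (suc n) zero = 1
fAux (suc n) 1 = 1
fAux (suc n) 2 = 1
fAux (suc n) 3 = 2
fAux (suc n) 4 = 2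
fAux (suc n) k@(suc (suc (suc (suc (suc m))))) =
  minFact (fAux n) k k (fAux n (k ∸ 1) + 1)

-- The function f of the paper (f 0 is junk and irrelevant).
f : ℕ → ℕ
f k = fAux k k

module Submission where

-- It suffices to find a with f x + a ≤ x + 1 and x ≤ a²:
-- then a ≤ x + 1 - f x and so x ≤ (x + 1 - f x)².  Three facts about f
-- give such an a:
--   (1) f grows by at most 1 per step:  f (y + d) ≤ f y + d  (y ≥ 2);
--   (2) f k ≤ k - 2 for k ≥ 4, so for a = b + 2 the factorization k = a·b
--       has candidate value ab - a - b + 1 + max (f a, b) = ab - a + 1,
--       i.e.  f (a·b) + a ≤ a·b + 1;
--   (3) every x lies in a bracket n² ≤ x ≤ (n+1)² (integer square root).
-- For x with n ≥ 3, take a = n + 1, b = n - 1: then a·b = n² - 1 ≤ x and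
-- by (1),(2)  f x + a ≤ x + 1, while x ≤ a².  The remaining x ≤ 9 are
-- checked by evaluation.

open import Defs
open import Data.Nat using (ℕ; zero; suc; _+_; _*_; _∸_; _≤_; _<_; _⊔_; _⊓_; _≤?_; _/_; z≤n; s≤s)
open import Data.Nat.Properties
open import Data.Nat.Divisibility using (_∣?_; n∣m*n)
open import Data.Nat.DivMod using (m*n/n≡m)
open import Data.Nat.Tactic.RingSolver using (solve-∀)
open import Data.Bool using (Bool; true; false; if_then_else_; _∧_; T)
open import Data.Bool.Properties using (T-∧)
open import Data.Product using (_×_; _,_; ∃-syntax)
open import Function.Bundles using (Equivalence)
open import Data.Empty using (⊥-elim)
open import Relation.Nullary using (Dec; does; yes; no; _because_; ofⁿ)
open import Relation.Nullary.Decidable using (from-yes; _×-dec_)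
open import Relation.Binary.PropositionalEquality using (_≡_; refl; sym; trans; cong; subst; module ≡-Reasoning)

SqrtBound : ℕ → Set
SqrtBound x = f x ≤ x + 1 × x ≤ (x + 1 ∸ f x) * (x + 1 ∸ f x)

sqrtBound? : (x : ℕ) → Dec (SqrtBound x)
sqrtBound? x = (f x ≤? x + 1) ×-dec (x ≤? (x + 1 ∸ f x) * (x + 1 ∸ f x))

admissible : ℕ → ℕ → Bool
admissible k i = does (k2 ∣? k) ∧ does (3 ≤? k / k2)
  where
  k2 : ℕ
  k2 = 2 + i

candidate : (ℕ → ℕ) → ℕ → ℕ → ℕ
candidate g k i = (k1 * k2 ∸ k1 ∸ k2) + 1 + (g k1 ⊔ k2)
  where
  k2 : ℕ
  k2 = 2 + i
  k1 : ℕ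
  k1 = k / k2

does-T : ∀ {A : Set} (d : Dec A) → A → T (does d)
does-T (true  because _)      _ = _
does-T (false because ofⁿ ¬a) a = ⊥-elim (¬a a)

if-min-≤-acc : ∀ b acc c → (if b then acc ⊓ c else acc) ≤ acc
if-min-≤-acc true  acc c = m⊓n≤m acc c
if-min-≤-acc false acc c = ≤-refl

if-min-≤-candidate : ∀ b acc c → T b → (if b then acc ⊓ c else acc) ≤ c
if-min-≤-candidate true acc c _ = m⊓n≤n acc c

minFact-≤-acc : ∀ g k j acc → minFact g k j acc ≤ acc
minFact-≤-acc g k zero    acc = ≤-refl
minFact-≤-acc g k (suc j) acc = ≤-trans (minFact-≤-acc g k j _) (if-min-≤-acc _ acc _)

minFact-≤-candidate : ∀ g k j acc i → i < j → T (admissible k i) →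
                      minFact g k j acc ≤ candidate g k i
minFact-≤-candidate g k (suc j) acc i (s≤s i≤j) adm with i ≟ j
... | yes refl = ≤-trans (minFact-≤-acc g k j _) (if-min-≤-candidate _ acc _ adm)
... | no  i≢j  = minFact-≤-candidate g k j _ i (≤∧≢⇒< i≤j i≢j) adm

-- Unfolding f at k ≥ 5: f k is at most every admissible candidate, computed
-- with the fuel k - 1 that the definition uses for the recursive calls.
f-≤-candidate : ∀ k i → 5 ≤ k → i < k → T (admissible k i) →
                f k ≤ candidate (fAux (k ∸ 1)) k i
f-≤-candidate (suc (suc (suc (suc (suc m))))) i (s≤s (s≤s (s≤s (s≤s (s≤s _))))) =
  minFact-≤-candidate (fAux (4 + m)) (5 + m) (5 + m) (f (4 + m) + 1) i

-- f k ≤ k - 2 for k ≥ 4, for every amount of fuel: f 4 = 2 and each later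
-- value is at most its predecessor plus one.
fAux-≤ : ∀ n k → 4 ≤ k → fAux n k ≤ k ∸ 2
fAux-≤ n 0 ()
fAux-≤ n 1 (s≤s ())
fAux-≤ n 2 (s≤s (s≤s ()))
fAux-≤ n 3 (s≤s (s≤s (s≤s ())))
fAux-≤ zero    (suc (suc (suc (suc k)))) _ = s≤s z≤n
fAux-≤ (suc n) 4 _ = ≤-refl
fAux-≤ (suc n) (suc (suc (suc (suc (suc m))))) _ = begin
    fAux (suc n) (5 + m) ≤⟨ minFact-≤-acc (fAux n) (5 + m) (5 + m) (fAux n (4 + m) + 1) ⟩
    fAux n (4 + m) + 1   ≤⟨ +-monoˡ-≤ 1 (fAux-≤ n (4 + m) (s≤s (s≤s (s≤s (s≤s z≤n))))) ⟩
    2 + m + 1            ≡⟨ +-comm (2 + m) 1 ⟩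
    3 + m ∎
  where open ≤-Reasoning

f-suc : ∀ k → 2 ≤ k → f (suc k) ≤ f k + 1
f-suc 0 ()
f-suc 1 (s≤s ())
f-suc 2 _ = s≤s (s≤s z≤n)
f-suc 3 _ = s≤s (s≤s z≤n)
f-suc (suc (suc (suc (suc m)))) _ = minFact-≤-acc (fAux (4 + m)) (5 + m) (5 + m) (f (4 + m) + 1)

f-shift : ∀ d y → 2 ≤ y → f (d + y) ≤ f y + d
f-shift zero    y _  = m≤m+n (f y) 0
f-shift (suc d) y 2≤y = begin
    f (suc (d + y)) ≤⟨ f-suc (d + y) (≤-trans 2≤y (m≤n+m y d)) ⟩
    f (d + y) + 1   ≤⟨ +-monoˡ-≤ 1 (f-shift d y 2≤y) ⟩
    f y + d + 1     ≡⟨ +-assoc (f y) d 1 ⟩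
    f y + (d + 1)   ≡⟨ cong (f y +_) (+-comm d 1) ⟩
    f y + suc d ∎
  where open ≤-Reasoning

-- For a, b ≥ 2 the sum is at most the product, so ab - a - b is honest.
+-≤-* : ∀ a b → 2 ≤ a → 2 ≤ b → a + b ≤ a * b
+-≤-* (suc (suc p)) (suc (suc q)) (s≤s (s≤s _)) (s≤s (s≤s _)) =
  ≤-trans (m≤m+n (2 + p + (2 + q)) (p * q + p + q)) (≤-reflexive (expand p q))
  where
  expand : ∀ p q → 2 + p + (2 + q) + (p * q + p + q) ≡ (2 + p) * (2 + q)
  expand = solve-∀

∸-∸-cancel : ∀ r s t → s + t ≤ r → (r ∸ s ∸ t) + 1 + t + s ≡ r + 1
∸-∸-cancel r s t s+t≤r = begin
    (r ∸ s ∸ t) + 1 + t + s   ≡⟨ regroup (r ∸ s ∸ t) s t ⟩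
    (r ∸ s ∸ t) + (s + t) + 1 ≡⟨ cong (λ u → u + (s + t) + 1) (∸-+-assoc r s t) ⟩
    (r ∸ (s + t)) + (s + t) + 1 ≡⟨ cong (_+ 1) (m∸n+n≡m s+t≤r) ⟩
    r + 1 ∎
  where
  open ≡-Reasoning
  regroup : ∀ u s t → u + 1 + t + s ≡ u + (s + t) + 1
  regroup = solve-∀

-- Fact (2) in general form: a factorization a · b with a ≥ 3, b ≥ 2 and
-- f a ≤ b (at every fuel) gives f (a · b) ≤ ab - a - b + 1 + b = ab - a + 1.
f-product : ∀ a b → 3 ≤ a → 2 ≤ b → (∀ n → fAux n a ≤ b) → f (a * b) + a ≤ a * b + 1
f-product a@(suc (suc (suc p))) b@(suc (suc q)) 3≤a@(s≤s (s≤s (s≤s _))) 2≤b@(s≤s (s≤s _)) fa≤b = begin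
    f (a * b) + a ≤⟨ +-monoˡ-≤ a (f-≤-candidate (a * b) q 5≤ab q<ab admissible-ab) ⟩
    candidate (fAux (a * b ∸ 1)) (a * b) q + a
      ≡⟨ cong (λ k1 → (k1 * b ∸ k1 ∸ b) + 1 + (fAux (a * b ∸ 1) k1 ⊔ b) + a) ab/b≡a ⟩
    (a * b ∸ a ∸ b) + 1 + (fAux (a * b ∸ 1) a ⊔ b) + a
      ≤⟨ +-monoˡ-≤ a (+-monoʳ-≤ ((a * b ∸ a ∸ b) + 1) (⊔-lub (fa≤b (a * b ∸ 1)) ≤-refl)) ⟩
    (a * b ∸ a ∸ b) + 1 + b + a ≡⟨ ∸-∸-cancel (a * b) a b (+-≤-* a b (≤-trans (n≤1+n 2) 3≤a) 2≤b) ⟩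
    a * b + 1 ∎
  where
  open ≤-Reasoning
  ab/b≡a : a * b / b ≡ a
  ab/b≡a = m*n/n≡m a b
  5≤ab : 5 ≤ a * b
  5≤ab = ≤-trans (n≤1+n 5) (*-mono-≤ 3≤a 2≤b)
  q<ab : q < a * b
  q<ab = ≤-trans (n≤1+n (suc q)) (m≤n*m b a)
  admissible-ab : T (admissible (a * b) q)
  admissible-ab = Equivalence.from T-∧
    ( does-T (b ∣? a * b) (n∣m*n a)
      , does-T (3 ≤? a * b / b) (subst (3 ≤_) (sym ab/b≡a) 3≤a))

-- Fact (2) as used: a = m + 4 and b = m + 2, where f a ≤ a - 2 = b.
f-near-square : ∀ m → f ((4 + m) * (2 + m)) + (4 + m) ≤ (4 + m) * (2 + m) + 1
f-near-square m = f-product (4 + m) (2 + m) (s≤s (s≤s (s≤s z≤n))) (s≤s (s≤s z≤n))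
  (λ n → fAux-≤ n (4 + m) (s≤s (s≤s (s≤s (s≤s z≤n)))))

sqrt-bracket : ∀ x → ∃[ n ] n * n ≤ x × x ≤ suc n * suc n
sqrt-bracket zero = 0 , z≤n , z≤n
sqrt-bracket (suc x) with sqrt-bracket x
... | n , lo , hi with suc x ≤? suc n * suc n
...   | yes x<[n+1]² = n , m≤n⇒m≤1+n lo , x<[n+1]²
...   | no  x≮[n+1]² = suc n , ≤-trans (≤-reflexive (sym x≡[n+1]²)) (n≤1+n x) ,
                         subst (λ y → suc y ≤ suc (suc n) * suc (suc n)) (sym x≡[n+1]²) [n+1]²<[n+2]²
  where
  x≡[n+1]² : x ≡ suc n * suc n
  x≡[n+1]² = ≤-antisym hi (≮⇒≥ x≮[n+1]²)
  [n+1]²<[n+2]² : suc n * suc n < suc (suc n) * suc (suc n)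
  [n+1]²<[n+2]² = *-mono-< (n<1+n (suc n)) (n<1+n (suc n))

sqrtBound-from : ∀ x k a → 2 ≤ k → k ≤ x → f k + a ≤ k + 1 → x ≤ a * a → SqrtBound x
sqrtBound-from x k a 2≤k k≤x fk+a≤k+1 x≤a² =
  ≤-trans (m≤m+n (f x) a) fx+a≤x+1 , ≤-trans x≤a² (*-mono-≤ a≤x+1-fx a≤x+1-fx)
  where
  x∸k+k≡x : (x ∸ k) + k ≡ x
  x∸k+k≡x = m∸n+n≡m k≤x
  fx≤fk+x∸k : f x ≤ f k + (x ∸ k)
  fx≤fk+x∸k = subst (λ y → f y ≤ f k + (x ∸ k)) x∸k+k≡x (f-shift (x ∸ k) k 2≤k)
  swap : ∀ p q r → p + q + r ≡ p + r + q
  swap = solve-∀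
  fx+a≤x+1 : f x + a ≤ x + 1
  fx+a≤x+1 = begin
    f x + a               ≤⟨ +-monoˡ-≤ a fx≤fk+x∸k ⟩
    f k + (x ∸ k) + a     ≡⟨ swap (f k) (x ∸ k) a ⟩
    f k + a + (x ∸ k)     ≤⟨ +-monoˡ-≤ (x ∸ k) fk+a≤k+1 ⟩
    k + 1 + (x ∸ k)       ≡⟨ trans (swap k 1 (x ∸ k)) (cong (_+ 1) (m+[n∸m]≡n k≤x)) ⟩
    x + 1 ∎
    where open ≤-Reasoning
  a≤x+1-fx : a ≤ x + 1 ∸ f x
  a≤x+1-fx = subst (_≤ x + 1 ∸ f x) (m+n∸m≡n (f x) a) (∸-monoˡ-≤ (f x) fx+a≤x+1)

sqrtBound-small : ∀ x → 2 ≤ x → x ≤ 9 → SqrtBound x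
sqrtBound-small 2 _ _ = from-yes (sqrtBound? 2)
sqrtBound-small 3 _ _ = from-yes (sqrtBound? 3)
sqrtBound-small 4 _ _ = from-yes (sqrtBound? 4)
sqrtBound-small 5 _ _ = from-yes (sqrtBound? 5)
sqrtBound-small 6 _ _ = from-yes (sqrtBound? 6)
sqrtBound-small 7 _ _ = from-yes (sqrtBound? 7)
sqrtBound-small 8 _ _ = from-yes (sqrtBound? 8)
sqrtBound-small 9 _ _ = from-yes (sqrtBound? 9)
sqrtBound-small 0 () _
sqrtBound-small 1 (s≤s ()) _
sqrtBound-small (suc (suc (suc (suc (suc (suc (suc (suc (suc (suc _)))))))))) _
  (s≤s (s≤s (s≤s (s≤s (s≤s (s≤s (s≤s (s≤s (s≤s ())))))))))

-- Main theorem: f x ≤ x - √x + 1 for x ≥ 2.  With n² ≤ x ≤ (n + 1)² and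
-- n = m + 3, the witness k = (m + 4)(m + 2) = n² - 1 ≤ x and a = n + 1.
mainTheorem6 : (x : ℕ) → 2 ≤ x →
    f x ≤ x + 1 × x ≤ (x + 1 ∸ f x) * (x + 1 ∸ f x)
mainTheorem6 x 2≤x with sqrt-bracket x
... | 0 , _ , x≤1 = sqrtBound-small x 2≤x (≤-trans x≤1 (s≤s z≤n))
... | 1 , _ , x≤4 = sqrtBound-small x 2≤x (≤-trans x≤4 (s≤s (s≤s (s≤s (s≤s z≤n)))))
... | 2 , _ , x≤9 = sqrtBound-small x 2≤x x≤9
... | suc (suc (suc m)) , n²≤x , x≤[n+1]² =
  sqrtBound-from x ((4 + m) * (2 + m)) (4 + m) 2≤k (≤-trans k≤n² n²≤x) (f-near-square m) x≤[n+1]²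
  where
  k≤n² : (4 + m) * (2 + m) ≤ (3 + m) * (3 + m)
  k≤n² = ≤-trans (m≤m+n _ 1) (≤-reflexive (square-minus-one m))
    where
    square-minus-one : ∀ m → (4 + m) * (2 + m) + 1 ≡ (3 + m) * (3 + m)
    square-minus-one = solve-∀
  2≤k : 2 ≤ (4 + m) * (2 + m)
  2≤k = ≤-trans (s≤s (s≤s z≤n)) (m≤n*m (2 + m) (4 + m))
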